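{- Let $G^c$ be a finite simple graph. If the eLehot algorithm, run on input $G^c$, produces an output multigraph $G'$, then $G'$ is a root graph of $G^c$, i.e. the line graph $L(G')$ is isomorphic to $G^c$.
   Context: For a (loopless, possibly multi-) graph $G'$, its line graph $L(G')$ has one vertex for each edge of $G'$, two vertices being adjacent iff the corresponding edges share an end vertex (in particular parallel edges give adjacent vertices). Two distinct vertices of a simple graph are true twins if they are adjacent and have equal closed neighbourhoods; this relation (with equality) is an equivalence relation whose classes are cliques. The eLehot algorithm on input $G^c$: Step 1: contract every edge of $G^c$ whose end vertices are true twins, obtaining the simple graph $H$ whose vertices are the true-twin classes of $G^c$ (two classes adjacent iff their vertices are adjacent in $G^c$), each vertex of $H$ labelled by the size (multiplicity) of its class. Step 2: run Lehot's algorithm on $H$; this either reports that $H$ is not the line graph of any simple graph, or outputs a simple graph $H'$ with $L(H')=H$ together with the correspondence between vertices of $H$ and edges of $H'$. Step 3: if $H'$ is output, replace each edge of $H'$ by as many parallel edges as the label of the corresponding vertex of $H$; the resulting multigraph $G'$ is the output. If Lehot's algorithm gives no root graph, eLehot has no output. -}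

module Defs where

open import Data.Nat using (ℕ)
open import Data.Fin using (Fin; _≟_)
open import Data.List using (List; length; filter; concatMap; replicate; lookup; allFin)
open import Data.Product using (Σ; ∃; _×_; _,_; proj₁; proj₂)
open import Data.Sum using (_⊎_)
open import Relation.Binary.PropositionalEquality using (_≡_; _≢_)
open import Relation.Nullary using (¬_)
open import Function.Bundles using (_⇔_; _⤖_; module Bijection)

record SimpleGraph (n : ℕ) : Set₁ where
  field
    Adj    : Fin n → Fin n → Set
    sym    : ∀ {u v} → Adj u v → Adj v u
    irrefl : ∀ {u} → ¬ Adj u u
open SimpleGraph public

record _≅_ {k n : ℕ} (G : SimpleGraph k) (H : SimpleGraph n) : Set where
  field
    bij   : Fin k ⤖ Fin n
    preserves : ∀ u v → Adj G u v ⇔ Adj H (Bijection.to bij u) (Bijection.to bij v)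

-- (Loopless, possibly multi-) graphs: vertex set Fin p, edges given as a
-- list of end-vertex pairs (parallel edges = repeated entries).

Edge : ℕ → Set
Edge p = Fin p × Fin p

ShareEnd : ∀ {p} → Edge p → Edge p → Set
ShareEnd (a , b) (c , d) = (a ≡ c ⊎ a ≡ d) ⊎ (b ≡ c ⊎ b ≡ d)

SameEnds : ∀ {p} → Edge p → Edge p → Set
SameEnds (a , b) (c , d) = (a ≡ c × b ≡ d) ⊎ (a ≡ d × b ≡ c)

record Multigraph : Set where
  field
    nV    : ℕ
    edges : List (Edge nV)
open Multigraph public

-- Line graph L(G'): one vertex per edge of G', distinct edges adjacent iff
-- they share an end vertex (parallel edges are thus adjacent).
lineGraph : (M : Multigraph) → SimpleGraph (length (edges M))
lineGraph M = record
  { Adj    = λ i j → i ≢ j × ShareEnd (lookup (edges M) i) (lookup (edges M) j)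
  ; sym    = λ { (i≢j , s) → (λ e → i≢j (symm e)) , swapS _ _ s }
  ; irrefl = λ { (i≢i , _) → i≢i reflexive }
  }
  where
  open import Relation.Binary.PropositionalEquality using (refl) renaming (sym to symm)
  reflexive : ∀ {A : Set} {x : A} → x ≡ x
  reflexive = refl
  swapS : ∀ {p} (e f : Edge p) → ShareEnd e f → ShareEnd f e
  swapS (a , b) (c , d) (Data.Sum.inj₁ (Data.Sum.inj₁ x)) = Data.Sum.inj₁ (Data.Sum.inj₁ (symm x))
  swapS (a , b) (c , d) (Data.Sum.inj₁ (Data.Sum.inj₂ x)) = Data.Sum.inj₂ (Data.Sum.inj₁ (symm x))
  swapS (a , b) (c , d) (Data.Sum.inj₂ (Data.Sum.inj₁ x)) = Data.Sum.inj₁ (Data.Sum.inj₂ (symm x))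
  swapS (a , b) (c , d) (Data.Sum.inj₂ (Data.Sum.inj₂ x)) = Data.Sum.inj₂ (Data.Sum.inj₂ (symm x))

ClosedNbhd : ∀ {n} → SimpleGraph n → Fin n → Fin n → Set
ClosedNbhd G u w = u ≡ w ⊎ Adj G u w

TrueTwins : ∀ {n} → SimpleGraph n → Fin n → Fin n → Set
TrueTwins G u v = u ≢ v × Adj G u v × (∀ w → ClosedNbhd G u w ⇔ ClosedNbhd G v w)

-- eLehot Step 1: contraction of true-twin classes.
-- A valid result of Step 1 is a number h of classes together with the
-- class map cls : Fin n → Fin h, which is onto and identifies exactly the
-- (reflexive closure of the) true-twin relation.

record TwinContraction {n : ℕ} (G : SimpleGraph n) : Set where
  field
    h         : ℕ
    cls       : Fin n → Fin h
    onto      : ∀ (a : Fin h) → ∃ λ u → cls u ≡ a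
    sameClass : ∀ u v → (cls u ≡ cls v) ⇔ (u ≡ v ⊎ TrueTwins G u v)

  HAdj : Fin h → Fin h → Set
  HAdj a b = a ≢ b × ∃ λ u → ∃ λ v → cls u ≡ a × cls v ≡ b × Adj G u v

  mult : Fin h → ℕ
  mult a = length (filter (λ u → cls u ≟ a) (allFin n))
open TwinContraction public

-- eLehot Step 2: a successful output of Lehot's algorithm on H is a
-- simple graph H' on Fin p whose edges are indexed by the vertices of H
-- (this indexing is the vertex/edge correspondence), with L(H') = H.

record LehotOutput {h : ℕ} (HAdj' : Fin h → Fin h → Set) : Set where
  field
    p        : ℕ
    ends     : Fin h → Edge p
    loopless : ∀ a → proj₁ (ends a) ≢ proj₂ (ends a)
    simple   : ∀ a b → SameEnds (ends a) (ends b) → a ≡ b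
    lineEq   : ∀ a b → HAdj' a b ⇔ (a ≢ b × ShareEnd (ends a) (ends b))
open LehotOutput public

eLehotOutput : ∀ {n} {G : SimpleGraph n} (T : TwinContraction G)
               → LehotOutput (HAdj T) → Multigraph
eLehotOutput T R = record
  { nV    = p R
  ; edges = concatMap (λ a → replicate (mult T a) (ends R a)) (allFin (h T))
  }

module Submission where

-- Write g = ends R ∘ cls T : Fin n → Edge p for the map sending a vertex of
-- G to the edge of the Lehot root H' that represents its twin class.  Say g represents G if two distinct
--    vertices are adjacent in G exactly when their g-edges share an end.
--    Then for every list L enumerating each vertex of G exactly once, the
--    line graph of the multigraph with edge list map g L is isomorphic to G,
--    via i ↦ lookup L i.
--  * Grouping by classes.  Listing the vertices of G class by class gives an
--    enumeration, and mapping g over it yields exactly the edge list of Step 3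
--    (each edge of H' repeated as often as its class is large).
--  * Twin classes.  Vertices of one class are adjacent, and have the same
--    neighbours outside the class; together with L(H') = H this shows that
--    g represents G.

open import Defs
open import Data.Nat using (ℕ)
open import Data.Fin using (Fin; zero; suc; _≟_; cast)
open import Data.Fin.Properties using (cast-involutive)
open import Data.List
  using (List; []; _∷_; map; length; filter; concatMap; replicate; lookup; allFin)
open import Data.List.Properties using (length-map; map-concatMap; concatMap-cong)
open import Data.List.Membership.Propositional using (_∈_)
open import Data.List.Membership.Propositional.Properties
  using (∈-++⁺ˡ; ∈-++⁺ʳ; ∈-++⁻; ∈-filter⁺; ∈-filter⁻; ∈-allFin; ∈-lookup)
open import Data.List.Relation.Unary.Any using (here; there; index)
open import Data.List.Relation.Unary.Any.Properties using (lookup-index)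
import Data.List.Relation.Unary.All as All
open import Data.List.Relation.Unary.AllPairs using ([]; _∷_)
open import Data.List.Relation.Unary.Unique.Propositional using (Unique)
open import Data.List.Relation.Unary.Unique.Propositional.Properties
  using (++⁺; filter⁺; allFin⁺)
open import Data.Product using (∃; _×_; _,_; proj₁; proj₂)
open import Data.Sum using (inj₁; inj₂)
open import Data.Empty using (⊥-elim)
open import Function using (_∘_)
open import Relation.Nullary using (yes; no)
open import Relation.Binary.PropositionalEquality
  using (_≡_; _≢_; refl; trans; cong; cong₂; subst₂; module ≡-Reasoning)
  renaming (sym to ≡-sym)
open import Function.Bundles using (_⇔_; mk⇔; _⤖_; module Bijection; Equivalence)

module _ {A : Set} where

  lookup-injective : (xs : List A) → Unique xs → ∀ i j → lookup xs i ≡ lookup xs j → i ≡ j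
  lookup-injective (x ∷ xs) u         zero    zero    e = refl
  lookup-injective (x ∷ xs) (x∉ ∷ u)  zero    (suc j) e = ⊥-elim (All.lookup x∉ (∈-lookup j) e)
  lookup-injective (x ∷ xs) (x∉ ∷ u)  (suc i) zero    e = ⊥-elim (All.lookup x∉ (∈-lookup i) (≡-sym e))
  lookup-injective (x ∷ xs) (_  ∷ u)  (suc i) (suc j) e = cong suc (lookup-injective xs u i j e)

  enumeration : (xs : List A) → Unique xs → (∀ x → x ∈ xs) → Fin (length xs) ⤖ A
  enumeration xs uniq complete = record
    { to        = lookup xs
    ; cong      = cong (lookup xs)
    ; bijective = lookup-injective xs uniq _ _
                , λ x → index (complete x) , λ { refl → ≡-sym (lookup-index (complete x)) }
    }

module _ {A B : Set} (f : A → B) where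

  lookup-map : (xs : List A) (i : Fin (length (map f xs)))
             → lookup (map f xs) i ≡ f (lookup xs (cast (length-map f xs) i))
  lookup-map (x ∷ xs) zero    = refl
  lookup-map (x ∷ xs) (suc i) = lookup-map xs i

Represents : ∀ {n p} → SimpleGraph n → (Fin n → Edge p) → Set
Represents G g = ∀ u v → (u ≢ v × ShareEnd (g u) (g v)) ⇔ Adj G u v

lineGraph-of-representation :
    ∀ {n p} (G : SimpleGraph n) (g : Fin n → Edge p) (L : List (Fin n)) (E : List (Edge p))
  → E ≡ map g L → Unique L → (∀ u → u ∈ L) → Represents G g
  → lineGraph (record { nV = p ; edges = E }) ≅ G
lineGraph-of-representation {n} {p} G g L .(map g L) refl uniq complete rep = record
  { bij       = record { to = to ; cong = cong to ; bijective = to-injective , to-surjective }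
  ; preserves = λ i j → mk⇔ (forward i j) (backward i j)
  }
  where
  module Enum = Bijection (enumeration L uniq complete)
  eq : length (map g L) ≡ length L
  eq = length-map g L

  to : Fin (length (map g L)) → Fin n
  to i = lookup L (cast eq i)

  to-injective : ∀ {i j} → to i ≡ to j → i ≡ j
  to-injective {i} {j} e = begin
    i                          ≡⟨ ≡-sym (cast-involutive (≡-sym eq) eq i) ⟩
    cast (≡-sym eq) (cast eq i) ≡⟨ cong (cast (≡-sym eq)) (Enum.injective e) ⟩
    cast (≡-sym eq) (cast eq j) ≡⟨ cast-involutive (≡-sym eq) eq j ⟩
    j                          ∎
    where open ≡-Reasoning

  to-surjective : ∀ u → ∃ λ i → ∀ {j} → j ≡ i → to j ≡ u
  to-surjective u = cast (≡-sym eq) k , λ { refl → trans (cong (lookup L) (cast-involutive eq (≡-sym eq) k)) k↦u }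
    where
    k : Fin (length L)
    k = proj₁ (Enum.surjective u)
    k↦u : lookup L k ≡ u
    k↦u = proj₂ (Enum.surjective u) refl

  edge-at : ∀ i → lookup (map g L) i ≡ g (to i)
  edge-at = lookup-map g L

  forward : ∀ i j → Adj (lineGraph (record { nV = p ; edges = map g L })) i j → Adj G (to i) (to j)
  forward i j (i≢j , share) = Equivalence.to (rep (to i) (to j))
    ( (λ e → i≢j (to-injective e))
    , subst₂ ShareEnd (edge-at i) (edge-at j) share )

  backward : ∀ i j → Adj G (to i) (to j) → Adj (lineGraph (record { nV = p ; edges = map g L })) i j
  backward i j adj with Equivalence.from (rep (to i) (to j)) adj
  ... | to-i≢to-j , share =
    (λ { refl → to-i≢to-j refl })
    , subst₂ ShareEnd (≡-sym (edge-at i)) (≡-sym (edge-at j)) share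

module Grouping {n h : ℕ} (c : Fin n → Fin h) where

  fibre : Fin h → List (Fin n)
  fibre a = filter (λ u → c u ≟ a) (allFin n)

  byClass : List (Fin h) → List (Fin n)
  byClass = concatMap fibre

  byClass⁺ : ∀ {u} as → c u ∈ as → u ∈ byClass as
  byClass⁺ {u} (a ∷ as) (here cu≡a) = ∈-++⁺ˡ (∈-filter⁺ (λ v → c v ≟ a) (∈-allFin u) cu≡a)
  byClass⁺     (a ∷ as) (there m)   = ∈-++⁺ʳ (fibre a) (byClass⁺ as m)

  byClass⁻ : ∀ {u} as → u ∈ byClass as → c u ∈ as
  byClass⁻ (a ∷ as) m with ∈-++⁻ (fibre a) m
  ... | inj₁ m′ = here (proj₂ (∈-filter⁻ (λ v → c v ≟ a) {xs = allFin n} m′))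
  ... | inj₂ m′ = there (byClass⁻ as m′)

  -- distinct classes are disjoint, so listing distinct classes repeats nothing
  byClass-unique : ∀ as → Unique as → Unique (byClass as)
  byClass-unique []       _          = []
  byClass-unique (a ∷ as) (a∉ ∷ uas) =
    ++⁺ (filter⁺ (λ v → c v ≟ a) (allFin⁺ n)) (byClass-unique as uas)
        λ { (m₁ , m₂) → All.lookup a∉ (byClass⁻ as m₂)
                          (≡-sym (proj₂ (∈-filter⁻ (λ v → c v ≟ a) {xs = allFin n} m₁))) }

  byClass-all-unique : Unique (byClass (allFin h))
  byClass-all-unique = byClass-unique (allFin h) (allFin⁺ h)

  byClass-all-complete : ∀ u → u ∈ byClass (allFin h)
  byClass-all-complete u = byClass⁺ (allFin h) (∈-allFin (c u))

  replicate-fibre : ∀ {E : Set} (f : Fin h → E) a (xs : List (Fin n))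
    → replicate (length (filter (λ u → c u ≟ a) xs)) (f a) ≡ map (f ∘ c) (filter (λ u → c u ≟ a) xs)
  replicate-fibre f a []       = refl
  replicate-fibre f a (x ∷ xs) with c x ≟ a
  ... | yes cx≡a = cong₂ _∷_ (cong f (≡-sym cx≡a)) (replicate-fibre f a xs)
  ... | no  _    = replicate-fibre f a xs

  expansion : ∀ {E : Set} (f : Fin h → E) as
    → concatMap (λ a → replicate (length (fibre a)) (f a)) as ≡ map (f ∘ c) (byClass as)
  expansion f as = begin
    concatMap (λ a → replicate (length (fibre a)) (f a)) as ≡⟨ concatMap-cong (λ a → replicate-fibre f a (allFin n)) as ⟩
    concatMap (map (f ∘ c) ∘ fibre) as                     ≡⟨ ≡-sym (map-concatMap (f ∘ c) fibre as) ⟩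
    map (f ∘ c) (byClass as)                               ∎
    where open ≡-Reasoning

module TwinClasses {n : ℕ} {G : SimpleGraph n} (T : TwinContraction G) where

  -- two distinct vertices of one class are true twins, hence adjacent
  sameClass-adjacent : ∀ u v → cls T u ≡ cls T v → u ≢ v → Adj G u v
  sameClass-adjacent u v e u≢v with Equivalence.to (sameClass T u v) e
  ... | inj₁ u≡v          = ⊥-elim (u≢v u≡v)
  ... | inj₂ (_ , uv , _) = uv

  neighbour-transfer : ∀ x u y → cls T x ≡ cls T u → cls T y ≢ cls T u → Adj G x y → Adj G u y
  neighbour-transfer x u y e y∉ xy with Equivalence.to (sameClass T x u) e
  ... | inj₁ refl = xy
  ... | inj₂ (_ , _ , sameNbhd) with Equivalence.to (sameNbhd y) (inj₂ xy)
  ...   | inj₁ refl = ⊥-elim (y∉ refl)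
  ...   | inj₂ uy   = uy

  classes-adjacent : ∀ u v → cls T u ≢ cls T v → HAdj T (cls T u) (cls T v) → Adj G u v
  classes-adjacent u v cu≢cv (_ , x , y , cx≡cu , cy≡cv , xy) =
    SimpleGraph.sym G (neighbour-transfer y v u cy≡cv cu≢cv
      (SimpleGraph.sym G (neighbour-transfer x u y cx≡cu (λ e → cu≢cv (trans (≡-sym e) cy≡cv)) xy)))

  root-represents : (R : LehotOutput (HAdj T)) → Represents G (ends R ∘ cls T)
  root-represents R u v = mk⇔ forward backward
    where
    forward : u ≢ v × ShareEnd (ends R (cls T u)) (ends R (cls T v)) → Adj G u v
    forward (u≢v , share) with cls T u ≟ cls T v
    ... | yes cu≡cv = sameClass-adjacent u v cu≡cv u≢v
    ... | no  cu≢cv = classes-adjacent u v cu≢cv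
                        (Equivalence.from (lineEq R (cls T u) (cls T v)) (cu≢cv , share))

    backward : Adj G u v → u ≢ v × ShareEnd (ends R (cls T u)) (ends R (cls T v))
    backward uv = (λ { refl → irrefl G uv }) , share
      where
      share : ShareEnd (ends R (cls T u)) (ends R (cls T v))
      share with cls T u ≟ cls T v
      ... | yes cu≡cv rewrite cu≡cv = inj₁ (inj₁ refl)
      ... | no  cu≢cv = proj₂ (Equivalence.to (lineEq R (cls T u) (cls T v))
                                (cu≢cv , u , v , refl , refl , uv))

theorem2 : ∀ (n : ℕ) (G : SimpleGraph n) (T : TwinContraction G)
    (R : LehotOutput (HAdj T))
    → lineGraph (eLehotOutput T R) ≅ G
theorem2 n G T R =
  lineGraph-of-representation G (ends R ∘ cls T) (byClass (allFin (h T))) _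
    (expansion (ends R) (allFin (h T)))
    byClass-all-unique
    byClass-all-complete
    (TwinClasses.root-represents T R)
  where open Grouping (cls T)
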